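{- Let $w$ be a finite word in the letters $1$ and $2$. Then $f_w$ is odd if and only if $w$ is of the form $a_0a_1\dotsb a_{k-1}$ or of the form $1a_0a_1\dotsb a_{k-1}$ for some $k\ge 0$, where each $a_i$ is either the word $2$ or the word $11$.
   Context: For $n\ge 0$, let $F(n)$ be the set of all words $w=x_1\dotsb x_l$ with each $x_i\in\{1,2\}$ and $\sum_i x_i=n$; the rank of such $w$ is $r(w)=n$, and $F=\coprod_{n\ge0}F(n)$ ($F(0)$ contains only the empty word $\emptyset$). The Young–Fibonacci graph has vertex set $F$, with an edge between $v\in F(n)$ and $w\in F(n+1)$ (written $v\in w^-$, $w\in v^+$) iff either (1) $v$ is obtained from $w$ by changing into a $1$ some $2$ of $w$ that has no $1$ to its left, or (2) $v$ is obtained from $w$ by removing its leftmost $1$. The $f$-statistic is defined recursively by $f_\emptyset=1$ and $f_w=\sum_{v\in w^- }f_v$ (equivalently, $f_w$ is the number of saturated chains from $\emptyset$ to $w$ in the poset where $w$ covers $v$ iff $v\in w^-$). -}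

module Defs where

open import Data.Nat using (ℕ; zero; suc; _+_)
open import Data.List using (List; []; _∷_; map; _++_)
open import Data.Nat.ListAction using (sum)
open import Data.Maybe using (Maybe; just; nothing)

data Letter : Set where
  one two : Letter

Word : Set
Word = List Letter

val : Letter → ℕ
val one = 1
val two = 2

rank : Word → ℕ
rank [] = 0
rank (x ∷ w) = val x + rank w

rule1 : Word → List Word
rule1 [] = []
rule1 (one ∷ w) = []
rule1 (two ∷ w) = (one ∷ w) ∷ map (two ∷_) (rule1 w)

rule2 : Word → Maybe Word
rule2 [] = nothing
rule2 (one ∷ w) = just w
rule2 (two ∷ w) with rule2 w
... | just v = just (two ∷ v)
... | nothing = nothing

maybeToList : {A : Set} → Maybe A → List A
maybeToList (just a) = a ∷ []
maybeToList nothing = []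

-- w⁻ : the lower covers of w in the Young–Fibonacci graph.
-- (Rule-1 outputs have the same length as w, the rule-2 output is
-- shorter, and distinct 2's give distinct rule-1 outputs, so this
-- list has no repetitions and represents the set w⁻.)
lower : Word → List Word
lower w = rule1 w ++ maybeToList (rule2 w)

-- f with explicit fuel; the recursion descends one rank per step.
fAux : ℕ → Word → ℕ
fAux zero [] = 1
fAux zero (_ ∷ _) = 0
fAux (suc n) w = sum (map (fAux n) (lower w))

-- f_w : f_∅ = 1, f_w = Σ_{v ∈ w⁻} f_v   (computed with fuel r(w))
f : Word → ℕ
f w = fAux (rank w) w

data Blocks : Word → Set where
  nil  : Blocks []
  cons2  : ∀ {w} → Blocks w → Blocks (two ∷ w)
  cons11 : ∀ {w} → Blocks w → Blocks (one ∷ one ∷ w)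

data OddForm : Word → Set where
  plain  : ∀ {w} → Blocks w → OddForm w
  lead1  : ∀ {w} → Blocks w → OddForm (one ∷ w)

-- Removing a leading 1 does not change f, and a leading 2 multiplies it by
-- r(w) + 1: the lower covers of 2w are 1w, whose only lower cover is w, and
-- the words 2v with v ∈ w⁻, which by induction contribute r(w) · f_w.
-- Hence f_w is odd iff every 2 of w is followed by a suffix of even rank,
-- and reading w from the right this is exactly the block decomposition.
module Submission where

open import Defs
open import Data.Nat using (_%_)
open import Relation.Binary.PropositionalEquality using (_≡_)
open import Function.Bundles using (_⇔_)

open import Data.Nat.Base using (ℕ; zero; suc; _+_; _*_; parity)
open import Data.Nat.Properties using (+-identityʳ; *-distribˡ-+; *-zeroʳ)
open import Data.Nat.ListAction using (sum)
open import Data.List.Base using ([]; _∷_; map; _++_)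
open import Data.List.Properties using (map-++; map-∘)
open import Data.Maybe.Base using (just; nothing)
open import Data.Parity.Base as ℙ using (0ℙ; 1ℙ; _⁻¹)
open import Data.Parity.Properties using (⁻¹-selfInverse; suc-homo-⁻¹; *-homo-*)
open import Data.Product.Base using (_×_; _,_)
open import Data.Product.Function.NonDependent.Propositional using (_×-⇔_)
open import Function.Base using (_∘_)
open import Function.Bundles using (mk⇔)
open import Function.Properties.Equivalence using (⇔-setoid)
import Function.Properties.Equivalence as ⇔
open import Level using (0ℓ)
open import Relation.Binary.PropositionalEquality using (refl; sym; trans; cong; cong₂; module ≡-Reasoning)
open import Relation.Nullary.Negation using (contradiction)

rule2-two∷ : ∀ w → maybeToList (rule2 (two ∷ w)) ≡ map (two ∷_) (maybeToList (rule2 w))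
rule2-two∷ w with rule2 w
... | just v  = refl
... | nothing = refl

lower-two∷ : ∀ w → lower (two ∷ w) ≡ (one ∷ w) ∷ map (two ∷_) (lower w)
lower-two∷ w = cong ((one ∷ w) ∷_) (begin
  map (two ∷_) (rule1 w) ++ maybeToList (rule2 (two ∷ w))
    ≡⟨ cong (map (two ∷_) (rule1 w) ++_) (rule2-two∷ w) ⟩
  map (two ∷_) (rule1 w) ++ map (two ∷_) (maybeToList (rule2 w))
    ≡⟨ map-++ (two ∷_) (rule1 w) (maybeToList (rule2 w)) ⟨
  map (two ∷_) (lower w) ∎)
  where open ≡-Reasoning

sum-map-scale : ∀ {A : Set} {g h : A → ℕ} k → (∀ x → g x ≡ k * h x) →
                ∀ xs → sum (map g xs) ≡ k * sum (map h xs)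
sum-map-scale k g≡k*h []                 = sym (*-zeroʳ k)
sum-map-scale {h = h} k g≡k*h (x ∷ xs) = trans
  (cong₂ _+_ (g≡k*h x) (sum-map-scale k g≡k*h xs))
  (sym (*-distribˡ-+ k (h x) (sum (map h xs))))

fAux-one∷ : ∀ n w → fAux (suc n) (one ∷ w) ≡ fAux n w
fAux-one∷ n w = +-identityʳ (fAux n w)

fAux-suc-two∷ : ∀ n w → fAux (suc n) (two ∷ w) ≡
                fAux n (one ∷ w) + sum (map (fAux n ∘ (two ∷_)) (lower w))
fAux-suc-two∷ n w = trans
  (cong (sum ∘ map (fAux n)) (lower-two∷ w))
  (cong (λ ws → fAux n (one ∷ w) + sum ws) (sym (map-∘ (lower w))))

-- With fuel 0 every nonempty word gets 0, so the scale factor is 0.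
fAux-1-two∷ : ∀ w → fAux 1 (two ∷ w) ≡ 0
fAux-1-two∷ w = trans (fAux-suc-two∷ 0 w) (sum-map-scale {h = fAux 0} 0 (λ _ → refl) (lower w))

fAux-two∷ : ∀ n w → fAux (suc (suc n)) (two ∷ w) ≡ suc n * fAux n w
sum-fAux-two∷ : ∀ n w → sum (map (fAux (suc n) ∘ (two ∷_)) (lower w)) ≡ n * fAux n w

fAux-two∷ n w = trans (fAux-suc-two∷ (suc n) w)
  (cong₂ _+_ (fAux-one∷ n w) (sum-fAux-two∷ n w))

sum-fAux-two∷ zero    w = sum-map-scale {h = fAux 0} 0 fAux-1-two∷ (lower w)
sum-fAux-two∷ (suc n) w = sum-map-scale (suc n) (fAux-two∷ n) (lower w)

f-one∷ : ∀ w → f (one ∷ w) ≡ f w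
f-one∷ w = fAux-one∷ (rank w) w

f-two∷ : ∀ w → f (two ∷ w) ≡ suc (rank w) * f w
f-two∷ w = fAux-two∷ (rank w) w

parity-suc : ∀ n → parity (suc n) ≡ parity n ⁻¹
parity-suc n = sym (⁻¹-selfInverse (suc-homo-⁻¹ n))

parity-f-two∷ : ∀ w → parity (f (two ∷ w)) ≡ parity (rank w) ⁻¹ ℙ.* parity (f w)
parity-f-two∷ w = trans (cong parity (f-two∷ w))
  (trans (*-homo-* (suc (rank w)) (f w)) (cong (ℙ._* parity (f w)) (parity-suc (rank w))))

p⁻¹*q≡1ℙ⇔ : ∀ p q → (p ⁻¹ ℙ.* q ≡ 1ℙ) ⇔ (p ≡ 0ℙ × q ≡ 1ℙ)
p⁻¹*q≡1ℙ⇔ 0ℙ 0ℙ = mk⇔ (λ ()) (λ { (_ , ()) })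
p⁻¹*q≡1ℙ⇔ 0ℙ 1ℙ = mk⇔ (λ _ → refl , refl) (λ _ → refl)
p⁻¹*q≡1ℙ⇔ 1ℙ q  = mk⇔ (λ ()) (λ { (() , _) })

n%2≡1⇔parity≡1ℙ : ∀ n → (n % 2 ≡ 1) ⇔ (parity n ≡ 1ℙ)
n%2≡1⇔parity≡1ℙ zero          = mk⇔ (λ ()) (λ ())
n%2≡1⇔parity≡1ℙ (suc zero)    = mk⇔ (λ _ → refl) (λ _ → refl)
n%2≡1⇔parity≡1ℙ (suc (suc n)) = n%2≡1⇔parity≡1ℙ n

Blocks⇒parity≡0ℙ : ∀ {w} → Blocks w → parity (rank w) ≡ 0ℙ
Blocks⇒parity≡0ℙ nil        = refl
Blocks⇒parity≡0ℙ (cons2 b)  = Blocks⇒parity≡0ℙ b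
Blocks⇒parity≡0ℙ (cons11 b) = Blocks⇒parity≡0ℙ b

OddForm-one∷ : ∀ {w} → OddForm (one ∷ w) ⇔ OddForm w
OddForm-one∷ = mk⇔ to from
  where
  to : ∀ {w} → OddForm (one ∷ w) → OddForm w
  to (plain (cons11 b)) = lead1 b
  to (lead1 b)          = plain b
  from : ∀ {w} → OddForm w → OddForm (one ∷ w)
  from (plain b) = lead1 b
  from (lead1 b) = plain (cons11 b)

OddForm-two∷ : ∀ {w} → OddForm (two ∷ w) ⇔ (parity (rank w) ≡ 0ℙ × OddForm w)
OddForm-two∷ = mk⇔ to from
  where
  to : ∀ {w} → OddForm (two ∷ w) → parity (rank w) ≡ 0ℙ × OddForm w
  to (plain (cons2 b)) = Blocks⇒parity≡0ℙ b , plain b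
  from : ∀ {w} → parity (rank w) ≡ 0ℙ × OddForm w → OddForm (two ∷ w)
  from (_    , plain b) = plain (cons2 b)
  -- The suffix 1v of 2·1v has odd rank, since v is a block word.
  from (even , lead1 {v} b) = contradiction
    (trans (sym even) (trans (parity-suc (rank v)) (cong _⁻¹ (Blocks⇒parity≡0ℙ b))))
    λ ()

parity-f≡1ℙ⇔OddForm : ∀ w → (parity (f w) ≡ 1ℙ) ⇔ OddForm w
parity-f≡1ℙ⇔OddForm [] = mk⇔ (λ _ → plain nil) (λ _ → refl)
parity-f≡1ℙ⇔OddForm (one ∷ w) = begin
  (parity (f (one ∷ w)) ≡ 1ℙ)  ≡⟨ cong (λ n → parity n ≡ 1ℙ) (f-one∷ w) ⟩
  (parity (f w) ≡ 1ℙ)          ≈⟨ parity-f≡1ℙ⇔OddForm w ⟩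
  OddForm w                    ≈⟨ OddForm-one∷ ⟨
  OddForm (one ∷ w)            ∎
  where open import Relation.Binary.Reasoning.Setoid (⇔-setoid 0ℓ)
parity-f≡1ℙ⇔OddForm (two ∷ w) = begin
  (parity (f (two ∷ w)) ≡ 1ℙ)                    ≡⟨ cong (_≡ 1ℙ) (parity-f-two∷ w) ⟩
  (parity (rank w) ⁻¹ ℙ.* parity (f w) ≡ 1ℙ)     ≈⟨ p⁻¹*q≡1ℙ⇔ (parity (rank w)) (parity (f w)) ⟩
  (parity (rank w) ≡ 0ℙ × parity (f w) ≡ 1ℙ)     ≈⟨ ⇔.refl ×-⇔ parity-f≡1ℙ⇔OddForm w ⟩
  (parity (rank w) ≡ 0ℙ × OddForm w)             ≈⟨ OddForm-two∷ ⟨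
  OddForm (two ∷ w)                              ∎
  where open import Relation.Binary.Reasoning.Setoid (⇔-setoid 0ℓ)

mainTheorem1 : (w : Word) → (f w % 2 ≡ 1) ⇔ OddForm w
mainTheorem1 w = ⇔.trans (n%2≡1⇔parity≡1ℙ (f w)) (parity-f≡1ℙ⇔OddForm w)
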